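{- Let $M=(ST,AC,\{av_A\}_{A\subseteq AG},\{out_A\}_{A\subseteq AG},lab)$ be an abstract multi-agent action model. The following three conditions are equivalent. (1) For every $A\subseteq AG$ and $s\in ST$, $av_A(s)=av_{AG}(s)|_A$. (2) For all $A,B\subseteq AG$ with $A\cap B=\emptyset$ and all $s\in ST$: (a) for every $\sigma_{A\cup B}\in av_{A\cup B}(s)$, $\sigma_{A\cup B}|_A\in av_A(s)$; (b) for every $\sigma_A\in av_A(s)$ there is $\sigma_B\in av_B(s)$ such that $\sigma_A\cup\sigma_B\in av_{A\cup B}(s)$. (3) For every $A\subseteq AG$ and $s\in ST$: (a) for every $\sigma_{AG}\in av_{AG}(s)$, $\sigma_{AG}|_A\in av_A(s)$; (b) for every $\sigma_A\in av_A(s)$ there is $\sigma_{\overline A}\in av_{\overline A}(s)$ such that $\sigma_A\cup\sigma_{\overline A}\in av_{AG}(s)$, where $\overline A=AG\setminus A$.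
   Context: Fix a nonempty finite set $AG$ of agents and a countable set $AP$ of atomic propositions; a coalition is any $A\subseteq AG$. Given a nonempty set $AC$ of actions, a joint action of $A$ is a function $\sigma_A:A\to AC$; $JA_A$ is the set of them ($JA_\emptyset=\{\emptyset\}$); joint actions are sets of ordered pairs, so unions apply; for $B\subseteq A$, $\sigma_A|_B$ is the restriction to $B$, and for a set $\Sigma$ of joint actions of $AG$, $\Sigma|_A=\{\sigma|_A:\sigma\in\Sigma\}$. An abstract multi-agent action model is $M=(ST,AC,\{av_A\},\{out_A\},lab)$ with $ST$ a nonempty set of states, $AC$ a nonempty set of actions, $av_A:ST\to\mathcal P(JA_A)$, $out_A:ST\times JA_A\to\mathcal P(ST)$, $lab:ST\to\mathcal P(AP)$. -}

module Defs where

open import Data.Nat using (ℕ)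
open import Data.Bool using (Bool; true; false; if_then_else_)
open import Data.Maybe using (Maybe; just; nothing; is-just)
open import Data.Vec using (Vec; map; zipWith)
open import Data.Fin.Subset using (Subset; ⊤; ⊥; ∁; _∩_; _∪_)
open import Data.Product using (Σ; ∃; _×_; _,_)
open import Function.Bundles using (_↣_)
open import Relation.Binary.PropositionalEquality using (_≡_)

-- Agents AG = Fin n; coalitions A ⊆ AG are Subset n (Vec Bool n, true = inside).
-- A (partial) joint action is a finite partial function AG ⇀ AC, encoded as a
-- vector of Maybe AC: σ is a joint action of coalition A iff its domain is A.
-- This encoding makes equality of joint actions (= equality of sets of pairs)
-- coincide with _≡_, without needing function extensionality.
PJA : Set → ℕ → Set
PJA AC n = Vec (Maybe AC) n

dom : ∀ {AC n} → PJA AC n → Subset n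
dom σ = map is-just σ

IsJA : ∀ {AC n} → Subset n → PJA AC n → Set
IsJA A σ = dom σ ≡ A

restrict : ∀ {AC n} → Subset n → PJA AC n → PJA AC n
restrict B σ = zipWith (λ b x → if b then x else nothing) B σ

-- union of joint actions as sets of pairs (used only for disjoint domains,
-- where it is exactly the set-theoretic union)
orElse : ∀ {AC : Set} → Maybe AC → Maybe AC → Maybe AC
orElse (just x) _ = just x
orElse nothing y = y

_∪ᴶ_ : ∀ {AC n} → PJA AC n → PJA AC n → PJA AC n
σ ∪ᴶ τ = zipWith orElse σ τ

record Model (n : ℕ) (AP : Set) : Set₁ where
  field
    ST     : Set
    st₀    : ST
    AC     : Set
    ac₀    : AC
    av     : Subset n → ST → PJA AC n → Set
    av-JA  : ∀ A s σ → av A s σ → IsJA A σ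
    out    : (A : Subset n) → ST → (σ : PJA AC n) → IsJA A σ → ST → Set
    lab    : ST → AP → Set

module _ {n : ℕ} {AP : Set} (M : Model n AP) where
  open Model M

  AG : Subset n
  AG = ⊤

  Cond1 : Set
  Cond1 = ∀ (A : Subset n) (s : ST) (σ : PJA AC n) →
    (av A s σ → ∃ λ τ → av AG s τ × restrict A τ ≡ σ) ×
    ((∃ λ τ → av AG s τ × restrict A τ ≡ σ) → av A s σ)

  Cond2 : Set
  Cond2 = ∀ (A B : Subset n) → A ∩ B ≡ ⊥ → (s : ST) →
    (∀ σ → av (A ∪ B) s σ → av A s (restrict A σ)) ×
    (∀ σA → av A s σA → ∃ λ σB → av B s σB × av (A ∪ B) s (σA ∪ᴶ σB))

  Cond3 : Set
  Cond3 = ∀ (A : Subset n) (s : ST) →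
    (∀ σ → av AG s σ → av A s (restrict A σ)) ×
    (∀ σA → av A s σA → ∃ λ σĀ → av (∁ A) s σĀ × av AG s (σA ∪ᴶ σĀ))

Countable : Set → Set
Countable X = X ↣ ℕ

{-# OPTIONS --safe #-}
-- (1) says that av_A(s) is exactly the image of av_AG(s) under restriction to A.
-- The cycle (1) ⇒ (2) ⇒ (3) ⇒ (1) then only uses that restricting twice is
-- restricting to the intersection, that restriction turns ∪ into ∪ᴶ, and that
-- A and ∁ A partition AG.
module Submission where

open import Defs
open import Data.Nat using (ℕ; suc)
open import Data.Bool using (true; false)
open import Data.Maybe using (just; nothing)
open import Data.Vec using ([]; _∷_)
open import Data.Fin.Subset using (Subset; ∁; _∩_; _∪_)
open import Data.Fin.Subset.Properties using (∩-abs-∪; ∩-inverseʳ; p∪∁p≡⊤)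
open import Data.Product using (∃; _×_; _,_; proj₁; proj₂)
open import Function.Base using (_∘_)
open import Function.Bundles using (_⇔_; mk⇔)
open import Relation.Binary.PropositionalEquality using (_≡_; refl; sym; cong; trans; subst)

restrict-restrict : ∀ {AC n} (A B : Subset n) (τ : PJA AC n) →
                    restrict A (restrict B τ) ≡ restrict (A ∩ B) τ
restrict-restrict []          []          []      = refl
restrict-restrict (true ∷ A)  (true ∷ B)  (x ∷ τ) = cong (x ∷_) (restrict-restrict A B τ)
restrict-restrict (true ∷ A)  (false ∷ B) (x ∷ τ) = cong (nothing ∷_) (restrict-restrict A B τ)
restrict-restrict (false ∷ A) (b ∷ B)     (x ∷ τ) = cong (nothing ∷_) (restrict-restrict A B τ)

restrict-∪ : ∀ {AC n} (A B : Subset n) (τ : PJA AC n) →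
             restrict A τ ∪ᴶ restrict B τ ≡ restrict (A ∪ B) τ
restrict-∪ []          []          []            = refl
restrict-∪ (true ∷ A)  (b ∷ B)     (just x ∷ τ)  = cong (just x ∷_) (restrict-∪ A B τ)
restrict-∪ (true ∷ A)  (true ∷ B)  (nothing ∷ τ) = cong (nothing ∷_) (restrict-∪ A B τ)
restrict-∪ (true ∷ A)  (false ∷ B) (nothing ∷ τ) = cong (nothing ∷_) (restrict-∪ A B τ)
restrict-∪ (false ∷ A) (b ∷ B)     (x ∷ τ)       = cong (_ ∷_) (restrict-∪ A B τ)

restrict-dom-∪ᴶ : ∀ {AC n} (σ τ : PJA AC n) → restrict (dom σ) (σ ∪ᴶ τ) ≡ σ
restrict-dom-∪ᴶ []            []      = refl
restrict-dom-∪ᴶ (just x ∷ σ)  (y ∷ τ) = cong (just x ∷_) (restrict-dom-∪ᴶ σ τ)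
restrict-dom-∪ᴶ (nothing ∷ σ) (y ∷ τ) = cong (nothing ∷_) (restrict-dom-∪ᴶ σ τ)

module _ {n : ℕ} {AP : Set} (M : Model n AP) where
  open Model M

  restrict-av-AG : Cond1 M → ∀ A s τ → av (AG M) s τ → av A s (restrict A τ)
  restrict-av-AG c1 A s τ τ∈av = proj₂ (c1 A s _) (τ , τ∈av , refl)

  Cond1⇒Cond2 : Cond1 M → Cond2 M
  Cond1⇒Cond2 c1 A B _ s = restrictˡ , extend
    where
    restrictˡ : ∀ σ → av (A ∪ B) s σ → av A s (restrict A σ)
    restrictˡ σ σ∈av with proj₁ (c1 (A ∪ B) s σ) σ∈av
    ... | τ , τ∈av , refl =
      subst (av A s) (sym restrictˡ-restrict-∪) (restrict-av-AG c1 A s τ τ∈av)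
      where
      restrictˡ-restrict-∪ : restrict A (restrict (A ∪ B) τ) ≡ restrict A τ
      restrictˡ-restrict-∪ =
        trans (restrict-restrict A (A ∪ B) τ) (cong (λ C → restrict C τ) (∩-abs-∪ A B))
    extend : ∀ σA → av A s σA → ∃ λ σB → av B s σB × av (A ∪ B) s (σA ∪ᴶ σB)
    extend σA σA∈av with proj₁ (c1 A s σA) σA∈av
    ... | τ , τ∈av , refl =
      restrict B τ , restrict-av-AG c1 B s τ τ∈av ,
      subst (av (A ∪ B) s) (sym (restrict-∪ A B τ))
            (restrict-av-AG c1 (A ∪ B) s τ τ∈av)

  Cond2⇒Cond3 : Cond2 M → Cond3 M
  Cond2⇒Cond3 c2 A s with c2 A (∁ A) (∩-inverseʳ A) s
  ... | restrictˡ , extend rewrite p∪∁p≡⊤ A = restrictˡ , extend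

  Cond3⇒Cond1 : Cond3 M → Cond1 M
  Cond3⇒Cond1 c3 A s σ = embed , restrict-av
    where
    embed : av A s σ → ∃ λ τ → av (AG M) s τ × restrict A τ ≡ σ
    embed σ∈av with proj₂ (c3 A s) σ σ∈av
    ... | σĀ , _ , σ∪σĀ∈av =
      σ ∪ᴶ σĀ , σ∪σĀ∈av , subst (λ C → restrict C (σ ∪ᴶ σĀ) ≡ σ) (av-JA A s σ σ∈av) (restrict-dom-∪ᴶ σ σĀ)
    restrict-av : (∃ λ τ → av (AG M) s τ × restrict A τ ≡ σ) → av A s σ
    restrict-av (τ , τ∈av , refl) = proj₁ (c3 A s) τ τ∈av

mainTheorem10 : ∀ {m : ℕ} {AP : Set} → Countable AP → (M : Model (suc m) AP) →
    (Cond1 M ⇔ Cond2 M) × (Cond1 M ⇔ Cond3 M)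
mainTheorem10 _ M =
  mk⇔ (Cond1⇒Cond2 M) (Cond3⇒Cond1 M ∘ Cond2⇒Cond3 M) ,
  mk⇔ (Cond2⇒Cond3 M ∘ Cond1⇒Cond2 M) (Cond3⇒Cond1 M)
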